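{- Let $s,t\ge 1$ be integers and let $q$ be a scalar with $q\neq -1$ and $(q+1)^2(s-1)(t-1)\neq st$. Let $\mathscr{D}(K_{s,t})$ be the $q$-distance matrix of $K_{s,t}$, with the $s$ vertices of one part listed first and the $t$ vertices of the other part listed last. Then $$\mathscr{D}(K_{s,t})^{ -1}=\frac{1}{(q+1)\left[(q+1)^2(s-1)(t-1)-st\right]}\begin{bmatrix}((q+1)^2(t-1)-t)\mathbf{J}_s & -(q+1)\mathbf{J}_{s\times t}\\ -(q+1)\mathbf{J}_{t\times s} & ((q+1)^2(s-1)-s)\mathbf{J}_t\end{bmatrix}-\frac{1}{q+1}\mathbf{I}_{s+t}.$$
   Context: $q$ is a real or complex number (the paper calls it an indeterminate). For an integer $\alpha\ge 1$ put $[\alpha]=1+q+\cdots+q^{\alpha-1}$, and $[0]=0$. The $q$-distance matrix of a connected graph with vertices $v_1,\dots,v_N$ is the $N\times N$ matrix with $(i,j)$ entry $[d(v_i,v_j)]$, $d$ the shortest-path distance. $\mathbf{J}_{m\times n}$ is the all-ones $m\times n$ matrix, $\mathbf{J}_m=\mathbf{J}_{m\times m}$, and $\mathbf{I}_n$ is the identity matrix. -}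

module Defs where

open import Level using (Level; _⊔_)
open import Data.Nat as ℕ using (ℕ)
open import Data.Fin as Fin using (Fin; toℕ)
open import Data.Bool using (Bool; true; false; if_then_else_)
open import Relation.Nullary using (¬_; does)
open import Data.Product using (_×_)
open import Algebra.Bundles using (CommutativeRing)

-- A field: a commutative ring with 1 ≉ 0 in which every nonzero element has
-- a multiplicative inverse.  The inverse is a total operation (value at 0 is
-- unconstrained), as in Lean/Mathlib.
record Field (c ℓ : Level) : Set (Level.suc (c ⊔ ℓ)) where
  field
    commutativeRing : CommutativeRing c ℓ
  open CommutativeRing commutativeRing public
  field
    _⁻¹      : Carrier → Carrier
    ⁻¹-cong  : ∀ {x y} → x ≈ y → x ⁻¹ ≈ y ⁻¹
    1≉0      : ¬ (1# ≈ 0#)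
    inverseʳ : ∀ x → ¬ (x ≈ 0#) → x * (x ⁻¹) ≈ 1#
  infix 8 _⁻¹

module FieldOps {c ℓ} (F : Field c ℓ) where
  open Field F hiding (zero)

  fromℕ : ℕ → Carrier
  fromℕ ℕ.zero    = 0#
  fromℕ (ℕ.suc n) = 1# + fromℕ n

  -- the q-number [α] = 1 + q + ... + q^(α-1), [0] = 0
  qnum : Carrier → ℕ → Carrier
  qnum q ℕ.zero    = 0#
  qnum q (ℕ.suc a) = 1# + q * qnum q a

  Matrix : ℕ → Set c
  Matrix n = Fin n → Fin n → Carrier

  ∑ : ∀ {n} → (Fin n → Carrier) → Carrier
  ∑ {ℕ.zero}  f = 0#
  ∑ {ℕ.suc n} f = f Fin.zero + ∑ (λ i → f (Fin.suc i))

  _⊗_ : ∀ {n} → Matrix n → Matrix n → Matrix n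
  (A ⊗ B) i j = ∑ (λ k → A i k * B k j)

  δ : ∀ {n} → Fin n → Fin n → Bool
  δ i j = does (i Fin.≟ j)

  identity : ∀ {n} → Matrix n
  identity i j = if δ i j then 1# else 0#

  _≈ᴹ_ : ∀ {n} → Matrix n → Matrix n → Set ℓ
  A ≈ᴹ B = ∀ i j → A i j ≈ B i j

  IsInverse : ∀ {n} → Matrix n → Matrix n → Set ℓ
  IsInverse {n} A B = ((A ⊗ B) ≈ᴹ identity) × ((B ⊗ A) ≈ᴹ identity)


  qDistanceMatrix : ∀ {n} → Carrier → (Fin n → Fin n → ℕ) → Matrix n
  qDistanceMatrix q d i j = qnum q (d i j)

-- Vertices of K_{s,t} are Fin (s + t); vertex i is in the first part
-- (of size s) iff toℕ i < s, else in the second part (of size t).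
inFirstPart : ∀ s {t} → Fin (s ℕ.+ t) → Bool
inFirstPart s i = does (toℕ i ℕ.<? s)

distK : ∀ s t → Fin (s ℕ.+ t) → Fin (s ℕ.+ t) → ℕ
distK s t i j with does (i Fin.≟ j)
... | true  = 0
... | false with inFirstPart s {t} i Data.Bool.xor inFirstPart s {t} j
...   | true  = 1
...   | false = 2

module _ {c ℓ} (F : Field c ℓ) where
  open Field F hiding (zero)
  open FieldOps F

  claimedInverseK : (s t : ℕ) → Carrier → Matrix (s ℕ.+ t)
  claimedInverseK s t q i j =
    ((q + 1#) * ((q + 1#) * (q + 1#) * fromℕ (s ℕ.∸ 1) * fromℕ (t ℕ.∸ 1) - fromℕ s * fromℕ t)) ⁻¹
      * (if inFirstPart s {t} i
         then (if inFirstPart s {t} j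
               then (q + 1#) * (q + 1#) * fromℕ (t ℕ.∸ 1) - fromℕ t
               else - (q + 1#))
         else (if inFirstPart s {t} j
               then - (q + 1#)
               else (q + 1#) * (q + 1#) * fromℕ (s ℕ.∸ 1) - fromℕ s))
    - (q + 1#) ⁻¹ * identity i j

{-# OPTIONS --safe #-}
module Submission where

-- Put p = q + 1 and Δ = p²(s-1)(t-1) - st. Since [0] = 0, [1] = 1 and [2] = p, the q-distance
-- matrix of K_{s,t} is Ĉ - pI, where X̂ is the matrix that is constant on the four blocks of
-- the bipartition with values given by a 2 × 2 pattern X, and C has p on the diagonal and 1
-- off it. The claimed inverse is uM̂ - p⁻¹I with u = (pΔ)⁻¹. Such "block constant plus scalar"
-- matrices multiply like 2 × 2 matrices: (Â + cI)(B̂ + dI) = (AΛB + dA + cB)^ + cdI with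
-- Λ = diag(s, t). The scalar part of either product is (-p)(-p⁻¹) = 1, and the block part
-- vanishes because of the 2 × 2 identities CΛM = pM + ΔC = MΛC together with uΔ = p⁻¹.

open import Defs
open import Algebra.Bundles using (CommutativeRing; RawRing)
open import Algebra.Solver.Ring.AlmostCommutativeRing
  using (fromCommutativeRing; _-Raw-AlmostCommutative⟶_; Induced-equivalence)
open import Data.Bool.Base using (Bool; true; false; if_then_else_; _xor_)
open import Data.Fin as Fin using (Fin)
open import Data.Integer.Base as ℤ using (ℤ; +_; -[1+_]; _⊖_; _◃_; sign; ∣_∣; +-*-rawRing)
import Data.Integer.Properties as ℤ
open import Data.Maybe.Base using (just; nothing)
open import Data.Nat.Base as ℕ using (ℕ; suc; zero; _≥_; _∸_)
import Data.Nat.Properties as ℕ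
open import Data.Product.Base using (_,_)
open import Data.Sign.Base as Sign using (Sign)
open import Function.Base using (_∘_)
open import Relation.Binary.Definitions using (WeaklyDecidable)
open import Relation.Binary.PropositionalEquality.Core as ≡ using (_≡_)
open import Relation.Nullary.Decidable.Core using (yes; no)
open import Relation.Nullary.Negation.Core using (¬_)

-- Integer coefficients let the ring solver cancel terms, which the library's solver with
-- natural coefficients cannot. Interpreting + n as the optimised n × 1# makes con (+ 1)
-- definitionally 1#, so that solver statements can mention 1# directly.
module IntegerCoefficients {c ℓ} (R : CommutativeRing c ℓ) where
  open CommutativeRing R
  open import Algebra.Properties.Ring ring using (-‿involutive; -0#≈0#; -‿+-comm; -1*x≈-x)
  open import Algebra.Properties.Semiring.Mult.TCOptimised semiring using (_×_; 1+×; ×-homo-+; ×1-homo-*)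
  open import Algebra.Properties.CommutativeSemigroup *-commutativeSemigroup using (interchange)
  open import Relation.Binary.Reasoning.Setoid setoid

  ⟦_⟧ℤ : ℤ → Carrier
  ⟦ + n ⟧ℤ    = n × 1#
  ⟦ -[1+ n ] ⟧ℤ = - (suc n × 1#)

  -‿homo : ∀ i → ⟦ ℤ.- i ⟧ℤ ≈ - ⟦ i ⟧ℤ
  -‿homo (+ zero)  = sym -0#≈0#
  -‿homo (+ suc n) = refl
  -‿homo -[1+ n ]  = sym (-‿involutive _)

  [x+y]-[x+z]≈y-z : ∀ x y z → (x + y) - (x + z) ≈ y - z
  [x+y]-[x+z]≈y-z x y z = begin
    (x + y) - (x + z)         ≈⟨ +-congˡ (-‿+-comm x z) ⟨
    (x + y) + (- x - z)       ≈⟨ +-congʳ (+-comm x y) ⟩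
    (y + x) + (- x - z)       ≈⟨ +-assoc y x _ ⟩
    y + (x + (- x - z))       ≈⟨ +-congˡ (+-assoc x (- x) (- z)) ⟨
    y + ((x - x) - z)         ≈⟨ +-congˡ (+-congʳ (-‿inverseʳ x)) ⟩
    y + (0# - z)              ≈⟨ +-congˡ (+-identityˡ (- z)) ⟩
    y - z                     ∎

  ⊖-homo : ∀ m n → ⟦ m ⊖ n ⟧ℤ ≈ m × 1# - n × 1#
  ⊖-homo zero    zero    = sym (-‿inverseʳ 0#)
  ⊖-homo zero    (suc n) = sym (+-identityˡ _)
  ⊖-homo (suc m) zero    = sym (trans (+-congˡ -0#≈0#) (+-identityʳ _))
  ⊖-homo (suc m) (suc n) = begin
    ⟦ suc m ⊖ suc n ⟧ℤ                 ≡⟨ ≡.cong ⟦_⟧ℤ (ℤ.[1+m]⊖[1+n]≡m⊖n m n) ⟩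
    ⟦ m ⊖ n ⟧ℤ                         ≈⟨ ⊖-homo m n ⟩
    m × 1# - n × 1#                    ≈⟨ [x+y]-[x+z]≈y-z 1# _ _ ⟨
    (1# + m × 1#) - (1# + n × 1#)      ≈⟨ +-cong (1+× m 1#) (-‿cong (1+× n 1#)) ⟨
    suc m × 1# - suc n × 1#            ∎

  +-homo : ∀ i j → ⟦ i ℤ.+ j ⟧ℤ ≈ ⟦ i ⟧ℤ + ⟦ j ⟧ℤ
  +-homo (+ m)     (+ n)     = ×-homo-+ 1# m n
  +-homo (+ m)     -[1+ n ]  = ⊖-homo m (suc n)
  +-homo -[1+ m ]  (+ n)     = trans (⊖-homo n (suc m)) (+-comm _ _)
  +-homo -[1+ m ]  -[1+ n ]  = begin
    - (suc (suc (m ℕ.+ n)) × 1#)        ≡⟨ ≡.cong (λ k → - (suc k × 1#)) (ℕ.+-suc m n) ⟨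
    - ((suc m ℕ.+ suc n) × 1#)          ≈⟨ -‿cong (×-homo-+ 1# (suc m) (suc n)) ⟩
    - (suc m × 1# + suc n × 1#)         ≈⟨ -‿+-comm _ _ ⟨
    - (suc m × 1#) - suc n × 1#         ∎

  ⟦_⟧ₛ : Sign → Carrier
  ⟦ Sign.+ ⟧ₛ = 1#
  ⟦ Sign.- ⟧ₛ = - 1#

  ⟦⟧ₛ-homo-* : ∀ σ τ → ⟦ σ Sign.* τ ⟧ₛ ≈ ⟦ σ ⟧ₛ * ⟦ τ ⟧ₛ
  ⟦⟧ₛ-homo-* Sign.+ τ      = sym (*-identityˡ _)
  ⟦⟧ₛ-homo-* Sign.- Sign.+ = sym (*-identityʳ _)
  ⟦⟧ₛ-homo-* Sign.- Sign.- = sym (trans (-1*x≈-x _) (-‿involutive 1#))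

  ◃-homo : ∀ σ n → ⟦ σ ◃ n ⟧ℤ ≈ ⟦ σ ⟧ₛ * n × 1#
  ◃-homo σ      zero    = sym (zeroʳ _)
  ◃-homo Sign.+ (suc n) = sym (*-identityˡ _)
  ◃-homo Sign.- (suc n) = sym (-1*x≈-x _)

  *-homo : ∀ i j → ⟦ i ℤ.* j ⟧ℤ ≈ ⟦ i ⟧ℤ * ⟦ j ⟧ℤ
  *-homo i j = begin
    ⟦ sign i Sign.* sign j ◃ ∣ i ∣ ℕ.* ∣ j ∣ ⟧ℤ
      ≈⟨ ◃-homo (sign i Sign.* sign j) (∣ i ∣ ℕ.* ∣ j ∣) ⟩
    ⟦ sign i Sign.* sign j ⟧ₛ * (∣ i ∣ ℕ.* ∣ j ∣) × 1#
      ≈⟨ *-cong (⟦⟧ₛ-homo-* (sign i) (sign j)) (×1-homo-* ∣ i ∣ ∣ j ∣) ⟩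
    (⟦ sign i ⟧ₛ * ⟦ sign j ⟧ₛ) * (∣ i ∣ × 1# * ∣ j ∣ × 1#)
      ≈⟨ interchange _ _ _ _ ⟩
    (⟦ sign i ⟧ₛ * ∣ i ∣ × 1#) * (⟦ sign j ⟧ₛ * ∣ j ∣ × 1#)
      ≈⟨ *-cong (◃-homo (sign i) ∣ i ∣) (◃-homo (sign j) ∣ j ∣) ⟨
    ⟦ sign i ◃ ∣ i ∣ ⟧ℤ * ⟦ sign j ◃ ∣ j ∣ ⟧ℤ
      ≡⟨ ≡.cong₂ (λ i′ j′ → ⟦ i′ ⟧ℤ * ⟦ j′ ⟧ℤ) (ℤ.◃-inverse i) (ℤ.◃-inverse j) ⟩
    ⟦ i ⟧ℤ * ⟦ j ⟧ℤ ∎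

  homomorphism : +-*-rawRing -Raw-AlmostCommutative⟶ fromCommutativeRing R
  homomorphism = record
    { ⟦_⟧ = ⟦_⟧ℤ ; +-homo = +-homo ; *-homo = *-homo ; -‿homo = -‿homo
    ; 0-homo = refl ; 1-homo = refl }

  _≟_ : WeaklyDecidable (Induced-equivalence homomorphism)
  i ≟ j with i ℤ.≟ j
  ... | yes ≡.refl = just refl
  ... | no _       = nothing

  open import Algebra.Solver.Ring +-*-rawRing (fromCommutativeRing R) homomorphism _≟_ public

module FieldProperties {c ℓ} (F : Field c ℓ) where
  open Field F
  open import Algebra.Properties.Ring ring using (x∙y⁻¹≈ε⇒x≈y)
  open IntegerCoefficients commutativeRing using (solve; _:=_; _:*_; :-_)
  open import Relation.Binary.Reasoning.Setoid setoid

  inverseˡ : ∀ x → ¬ x ≈ 0# → x ⁻¹ * x ≈ 1#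
  inverseˡ x x≉0 = trans (*-comm _ _) (inverseʳ x x≉0)

  x≉y⇒x-y≉0 : ∀ {x y} → ¬ x ≈ y → ¬ x - y ≈ 0#
  x≉y⇒x-y≉0 x≉y x-y≈0 = x≉y (x∙y⁻¹≈ε⇒x≈y _ _ x-y≈0)

  x*y≉0 : ∀ {x y} → ¬ x ≈ 0# → ¬ y ≈ 0# → ¬ x * y ≈ 0#
  x*y≉0 {x} {y} x≉0 y≉0 xy≈0 = y≉0 (begin
    y                ≈⟨ *-identityˡ y ⟨
    1# * y           ≈⟨ *-congʳ (inverseˡ x x≉0) ⟨
    x ⁻¹ * x * y     ≈⟨ *-assoc _ _ _ ⟩
    x ⁻¹ * (x * y)   ≈⟨ *-congˡ xy≈0 ⟩
    x ⁻¹ * 0#        ≈⟨ zeroʳ _ ⟩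
    0#               ∎)

  -x*-x⁻¹≈1 : ∀ {x} → ¬ x ≈ 0# → - x * - (x ⁻¹) ≈ 1#
  -x*-x⁻¹≈1 {x} x≉0 =
    trans (solve 2 (λ x x′ → :- x :* :- x′ := x :* x′) refl x (x ⁻¹)) (inverseʳ x x≉0)

  [x*y]⁻¹*y≈x⁻¹ : ∀ {x y} → ¬ x ≈ 0# → ¬ y ≈ 0# → (x * y) ⁻¹ * y ≈ x ⁻¹
  [x*y]⁻¹*y≈x⁻¹ {x} {y} x≉0 y≉0 = begin
    (x * y) ⁻¹ * y                    ≈⟨ *-identityˡ _ ⟨
    1# * ((x * y) ⁻¹ * y)             ≈⟨ *-congʳ (inverseˡ x x≉0) ⟨
    x ⁻¹ * x * ((x * y) ⁻¹ * y)
      ≈⟨ solve 4 (λ x′ x w y → x′ :* x :* (w :* y) := x′ :* (x :* y :* w)) refl (x ⁻¹) x ((x * y) ⁻¹) y ⟩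
    x ⁻¹ * (x * y * (x * y) ⁻¹)       ≈⟨ *-congˡ (inverseʳ (x * y) (x*y≉0 x≉0 y≉0)) ⟩
    x ⁻¹ * 1#                         ≈⟨ *-identityʳ _ ⟩
    x ⁻¹                              ∎

module Matrices {c ℓ} (F : Field c ℓ) where
  open Field F hiding (zero)
  open FieldOps F
  open import Algebra.Properties.CommutativeSemigroup +-commutativeSemigroup using (interchange)
  open import Relation.Binary.Reasoning.Setoid setoid

  ∑-cong : ∀ {n} {f g : Fin n → Carrier} → (∀ k → f k ≈ g k) → ∑ f ≈ ∑ g
  ∑-cong {zero}  f≈g = refl
  ∑-cong {suc n} f≈g = +-cong (f≈g Fin.zero) (∑-cong (f≈g ∘ Fin.suc))

  ∑-zero : ∀ {n} {f : Fin n → Carrier} → (∀ k → f k ≈ 0#) → ∑ f ≈ 0#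
  ∑-zero {zero}  f≈0 = refl
  ∑-zero {suc n} f≈0 = trans (+-cong (f≈0 Fin.zero) (∑-zero (f≈0 ∘ Fin.suc))) (+-identityʳ 0#)

  ∑-distrib-+ : ∀ {n} (f g : Fin n → Carrier) → ∑ (λ k → f k + g k) ≈ ∑ f + ∑ g
  ∑-distrib-+ {zero}  f g = sym (+-identityˡ 0#)
  ∑-distrib-+ {suc n} f g =
    trans (+-congˡ (∑-distrib-+ (f ∘ Fin.suc) (g ∘ Fin.suc))) (interchange _ _ _ _)

  *-distribˡ-∑ : ∀ {n} x (f : Fin n → Carrier) → x * ∑ f ≈ ∑ (λ k → x * f k)
  *-distribˡ-∑ {zero}  x f = zeroʳ x
  *-distribˡ-∑ {suc n} x f = trans (distribˡ x _ _) (+-congˡ (*-distribˡ-∑ x (f ∘ Fin.suc)))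

  ∑-const : ∀ n x → ∑ {n} (λ _ → x) ≈ fromℕ n * x
  ∑-const zero    x = sym (zeroˡ x)
  ∑-const (suc n) x =
    trans (+-cong (sym (*-identityˡ x)) (∑-const n x)) (sym (distribʳ x 1# (fromℕ n)))

  ∑-identityˡ : ∀ {n} (f : Fin n → Carrier) i → ∑ (λ k → identity i k * f k) ≈ f i
  ∑-identityˡ f Fin.zero    =
    trans (+-cong (*-identityˡ _) (∑-zero (λ k → zeroˡ (f (Fin.suc k))))) (+-identityʳ _)
  ∑-identityˡ f (Fin.suc i) = trans (+-cong (zeroˡ _) (∑-identityˡ (f ∘ Fin.suc) i)) (+-identityˡ _)

  ∑-identityʳ : ∀ {n} (f : Fin n → Carrier) j → ∑ (λ k → f k * identity k j) ≈ f j
  ∑-identityʳ f Fin.zero    =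
    trans (+-cong (*-identityʳ _) (∑-zero (λ k → zeroʳ (f (Fin.suc k))))) (+-identityʳ _)
  ∑-identityʳ f (Fin.suc j) = trans (+-cong (zeroʳ _) (∑-identityʳ (f ∘ Fin.suc) j)) (+-identityˡ _)

  ∑-inFirstPart : ∀ s t (G : Bool → Carrier) →
    ∑ (λ k → G (inFirstPart s {t} k)) ≈ fromℕ s * G true + fromℕ t * G false
  ∑-inFirstPart zero t G = begin
    ∑ {t} (λ _ → G false)                  ≈⟨ ∑-const t (G false) ⟩
    fromℕ t * G false                      ≈⟨ +-identityˡ _ ⟨
    0# + fromℕ t * G false                 ≈⟨ +-congʳ (zeroˡ (G true)) ⟨
    0# * G true + fromℕ t * G false        ∎
  ∑-inFirstPart (suc s) t G = begin
    G true + ∑ (λ k → G (inFirstPart s {t} k))              ≈⟨ +-congˡ (∑-inFirstPart s t G) ⟩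
    G true + (fromℕ s * G true + fromℕ t * G false)         ≈⟨ +-assoc _ _ _ ⟨
    G true + fromℕ s * G true + fromℕ t * G false           ≈⟨ +-congʳ (+-congʳ (*-identityˡ _)) ⟨
    1# * G true + fromℕ s * G true + fromℕ t * G false      ≈⟨ +-congʳ (distribʳ _ _ _) ⟨
    (1# + fromℕ s) * G true + fromℕ t * G false             ∎

  ⊗-cong : ∀ {n} {A A′ B B′ : Matrix n} → A ≈ᴹ A′ → B ≈ᴹ B′ → (A ⊗ B) ≈ᴹ (A′ ⊗ B′)
  ⊗-cong A≈A′ B≈B′ i j = ∑-cong (λ k → *-cong (A≈A′ i k) (B≈B′ k j))

module QNumbers {c ℓ} (F : Field c ℓ) where
  open Field F
  open FieldOps F using (qnum)
  open IntegerCoefficients commutativeRing using (solve; _:=_; _:+_; _:*_; con)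

  qnum-1 : ∀ q → qnum q 1 ≈ 1#
  qnum-1 q = trans (+-congˡ (zeroʳ q)) (+-identityʳ 1#)

  qnum-2 : ∀ q → qnum q 2 ≈ q + 1#
  qnum-2 = solve 1 (λ q → con (+ 1) :+ q :* (con (+ 1) :+ q :* con (+ 0)) := q :+ con (+ 1)) refl

module Blocks {c ℓ} (R : RawRing c ℓ) where
  open RawRing R
  open import Data.Product.Base using (_×_)

  Block : Set c
  Block = Bool → Bool → Carrier

  weightedProduct : Carrier → Carrier → Block → Block → Block
  weightedProduct σ τ A B x y = σ * (A x true * B true y) + τ * (A x false * B false y)

  scale : Carrier → Block → Block
  scale u A x y = u * A x y

  productBlock : Carrier → Carrier → Block → Carrier → Block → Carrier → Block
  productBlock σ τ A c B d x y = weightedProduct σ τ A B x y + d * A x y + c * B x y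

  distanceBlock : Carrier → Block
  distanceBlock p x y = if x xor y then 1# else p

  distanceBlock-diagonal : ∀ p x → distanceBlock p x x ≡ p
  distanceBlock-diagonal p true  = ≡.refl
  distanceBlock-diagonal p false = ≡.refl

  module CompleteBipartite (p a b : Carrier) where

    Δ : Carrier
    Δ = p * p * a * b + - ((1# + a) * (1# + b))

    inverseBlock : Block
    inverseBlock x y =
      if x then (if y then p * p * b + - (1# + b) else - p)
           else (if y then - p else p * p * a + - (1# + a))

    _⊙_ : Block → Block → Block
    _⊙_ = weightedProduct (1# + a) (1# + b)

    _⊛_ : Block × Carrier → Block × Carrier → Block
    (A , c) ⊛ (B , d) = productBlock (1# + a) (1# + b) A c B d

module CompleteBipartiteIdentities {c ℓ} (R : CommutativeRing c ℓ) where
  open CommutativeRing R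
  open IntegerCoefficients R using (solve; _:=_; _:+_; _:*_; :-_; _:-_; con; Polynomial)
  open Blocks rawRing
  open import Data.Product.Base using (_×_)
  open import Relation.Binary.Reasoning.Setoid setoid

  -- The Blocks definitions are stated over a raw ring so that they can be instantiated at
  -- polynomials and handed to the solver; there each entry is a polynomial identity in p, a, b.
  private
    polynomialRing : RawRing _ _
    polynomialRing = record
      { Carrier = Polynomial 3 ; _≈_ = _≡_ ; _+_ = _:+_ ; _*_ = _:*_ ; -_ = :-_
      ; 0# = con (+ 0) ; 1# = con (+ 1) }

    module P = Blocks polynomialRing

    distance⊙inverseᴾ inverse⊙distanceᴾ :
      Bool → Bool → (p a b : Polynomial 3) → Polynomial 3 × Polynomial 3
    distance⊙inverseᴾ x y p a b =
      (P.distanceBlock p ⊙ inverseBlock) x y := p :* inverseBlock x y :+ Δ :* P.distanceBlock p x y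
      where open P.CompleteBipartite p a b
    inverse⊙distanceᴾ x y p a b =
      (inverseBlock ⊙ P.distanceBlock p) x y := p :* inverseBlock x y :+ Δ :* P.distanceBlock p x y
      where open P.CompleteBipartite p a b

  weightedProduct-*ˡ : ∀ σ τ u A B x y →
    weightedProduct σ τ (scale u A) B x y ≈ u * weightedProduct σ τ A B x y
  weightedProduct-*ˡ σ τ u A B x y =
    solve 7 (λ σ τ u A₁ A₂ B₁ B₂ → σ :* (u :* A₁ :* B₁) :+ τ :* (u :* A₂ :* B₂)
                                   := u :* (σ :* (A₁ :* B₁) :+ τ :* (A₂ :* B₂))) refl
      σ τ u (A x true) (A x false) (B true y) (B false y)

  weightedProduct-*ʳ : ∀ σ τ u A B x y →
    weightedProduct σ τ A (scale u B) x y ≈ u * weightedProduct σ τ A B x y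
  weightedProduct-*ʳ σ τ u A B x y =
    solve 7 (λ σ τ u A₁ A₂ B₁ B₂ → σ :* (A₁ :* (u :* B₁)) :+ τ :* (A₂ :* (u :* B₂))
                                   := u :* (σ :* (A₁ :* B₁) :+ τ :* (A₂ :* B₂))) refl
      σ τ u (A x true) (A x false) (B true y) (B false y)

  module _ (p a b : Carrier) where
    open CompleteBipartite p a b

    distance⊙inverse : ∀ x y →
      (distanceBlock p ⊙ inverseBlock) x y ≈ p * inverseBlock x y + Δ * distanceBlock p x y
    distance⊙inverse true  true  = solve 3 (distance⊙inverseᴾ true  true)  refl p a b
    distance⊙inverse true  false = solve 3 (distance⊙inverseᴾ true  false) refl p a b
    distance⊙inverse false true  = solve 3 (distance⊙inverseᴾ false true)  refl p a b
    distance⊙inverse false false = solve 3 (distance⊙inverseᴾ false false) refl p a b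

    inverse⊙distance : ∀ x y →
      (inverseBlock ⊙ distanceBlock p) x y ≈ p * inverseBlock x y + Δ * distanceBlock p x y
    inverse⊙distance true  true  = solve 3 (inverse⊙distanceᴾ true  true)  refl p a b
    inverse⊙distance true  false = solve 3 (inverse⊙distanceᴾ true  false) refl p a b
    inverse⊙distance false true  = solve 3 (inverse⊙distanceᴾ false true)  refl p a b
    inverse⊙distance false false = solve 3 (inverse⊙distanceᴾ false false) refl p a b

    module _ {u v : Carrier} (uΔ≈v : u * Δ ≈ v) where

      private
        [uΔ-v]*x≈0 : ∀ x → (u * Δ - v) * x ≈ 0#
        [uΔ-v]*x≈0 x = trans (*-congʳ (trans (+-congʳ uΔ≈v) (-‿inverseʳ v))) (zeroˡ x)

      distance⊛inverse≈0 : ∀ x y → ((distanceBlock p , - p) ⊛ (scale u inverseBlock , - v)) x y ≈ 0#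
      distance⊛inverse≈0 x y = begin
        (distanceBlock p ⊙ scale u inverseBlock) x y + - v * C + - p * (u * M)
          ≈⟨ +-congʳ (+-congʳ (trans (weightedProduct-*ʳ _ _ u (distanceBlock p) inverseBlock x y)
                                     (*-congˡ (distance⊙inverse x y)))) ⟩
        u * (p * M + Δ * C) + - v * C + - p * (u * M)
          ≈⟨ solve 6 (λ u v p M Δ C → u :* (p :* M :+ Δ :* C) :+ :- v :* C :+ :- p :* (u :* M)
                                      := (u :* Δ :- v) :* C) refl u v p M Δ C ⟩
        (u * Δ - v) * C
          ≈⟨ [uΔ-v]*x≈0 C ⟩
        0# ∎
        where
        M C : Carrier
        M = inverseBlock x y
        C = distanceBlock p x y

      inverse⊛distance≈0 : ∀ x y → ((scale u inverseBlock , - v) ⊛ (distanceBlock p , - p)) x y ≈ 0#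
      inverse⊛distance≈0 x y = begin
        (scale u inverseBlock ⊙ distanceBlock p) x y + - p * (u * M) + - v * C
          ≈⟨ +-congʳ (+-congʳ (trans (weightedProduct-*ˡ _ _ u inverseBlock (distanceBlock p) x y)
                                     (*-congˡ (inverse⊙distance x y)))) ⟩
        u * (p * M + Δ * C) + - p * (u * M) + - v * C
          ≈⟨ solve 6 (λ u v p M Δ C → u :* (p :* M :+ Δ :* C) :+ :- p :* (u :* M) :+ :- v :* C
                                      := (u :* Δ :- v) :* C) refl u v p M Δ C ⟩
        (u * Δ - v) * C
          ≈⟨ [uΔ-v]*x≈0 C ⟩
        0# ∎
        where
        M C : Carrier
        M = inverseBlock x y
        C = distanceBlock p x y

module BlockMatrices {c ℓ} (F : Field c ℓ) (s t : ℕ) where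
  open Field F
  open FieldOps F
  open Blocks rawRing
  open Matrices F
  open QNumbers F
  open IntegerCoefficients commutativeRing using (solve; _:=_; _:+_; _:*_)
  open import Relation.Binary.Reasoning.Setoid setoid

  N : ℕ
  N = s ℕ.+ t

  part : Fin N → Bool
  part = inFirstPart s {t}

  blockMatrix : Block → Carrier → Matrix N
  blockMatrix A c i j = A (part i) (part j) + c * identity i j

  private
    expand : ∀ x c e y d e′ →
      (x + c * e) * (y + d * e′) ≈ x * y + d * (x * e′) + c * (e * y) + c * d * (e * e′)
    expand = solve 6 (λ x c e y d e′ → (x :+ c :* e) :* (y :+ d :* e′)
                        := x :* y :+ d :* (x :* e′) :+ c :* (e :* y) :+ c :* d :* (e :* e′)) refl

    x+y*0≈x : ∀ x y → x + y * 0# ≈ x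
    x+y*0≈x x y = trans (+-congˡ (zeroʳ y)) (+-identityʳ x)

    ∑-scaled : ∀ {n} x (f : Fin n → Carrier) {y} → ∑ f ≈ y → ∑ (λ k → x * f k) ≈ x * y
    ∑-scaled x f ∑f≈y = trans (sym (*-distribˡ-∑ x f)) (*-congˡ ∑f≈y)

  ⊗-blockMatrix : ∀ A c B d →
    (blockMatrix A c ⊗ blockMatrix B d) ≈ᴹ blockMatrix (productBlock (fromℕ s) (fromℕ t) A c B d) (c * d)
  ⊗-blockMatrix A c B d i j = begin
    ∑ (λ k → (A (part i) (part k) + c * identity i k) * (B (part k) (part j) + d * identity k j))
      ≈⟨ ∑-cong (λ k → expand _ c (identity i k) _ d (identity k j)) ⟩
    ∑ (λ k → AB k + d * AI k + c * IB k + c * d * II k)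
      ≈⟨ trans (∑-distrib-+ {N} _ _)
               (+-congʳ (trans (∑-distrib-+ {N} _ _) (+-congʳ (∑-distrib-+ {N} _ _)))) ⟩
    ∑ AB + ∑ (λ k → d * AI k) + ∑ (λ k → c * IB k) + ∑ (λ k → c * d * II k)
      ≈⟨ +-cong (+-cong (+-cong (∑-inFirstPart s t (λ y → A (part i) y * B y (part j)))
                                (∑-scaled d AI (∑-identityʳ (λ k → A (part i) (part k)) j)))
                        (∑-scaled c IB (∑-identityˡ (λ k → B (part k) (part j)) i)))
                (∑-scaled (c * d) II (∑-identityˡ (λ k → identity k j) i)) ⟩
    blockMatrix (productBlock (fromℕ s) (fromℕ t) A c B d) (c * d) i j ∎
    where
    AB AI IB II : Fin N → Carrier
    AB k = A (part i) (part k) * B (part k) (part j)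
    AI k = A (part i) (part k) * identity k j
    IB k = identity i k * B (part k) (part j)
    II k = identity i k * identity k j

  blockMatrix-inverse : ∀ {A c B d} → (∀ x y → productBlock (fromℕ s) (fromℕ t) A c B d x y ≈ 0#) →
    c * d ≈ 1# → (blockMatrix A c ⊗ blockMatrix B d) ≈ᴹ identity
  blockMatrix-inverse {A} {c} {B} {d} block≈0 cd≈1 i j = begin
    (blockMatrix A c ⊗ blockMatrix B d) i j  ≈⟨ ⊗-blockMatrix A c B d i j ⟩
    _ + c * d * identity i j                  ≈⟨ +-cong (block≈0 (part i) (part j)) (*-congʳ cd≈1) ⟩
    0# + 1# * identity i j                    ≈⟨ trans (+-identityˡ _) (*-identityˡ _) ⟩
    identity i j                              ∎

  qDistance≈blockMatrix : ∀ q →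
    qDistanceMatrix q (distK s t) ≈ᴹ blockMatrix (distanceBlock (q + 1#)) (- (q + 1#))
  qDistance≈blockMatrix q i j with i Fin.≟ j
  ... | yes ≡.refl = sym (begin
    distanceBlock p (part i) (part i) + - p * 1#
      ≡⟨ ≡.cong (_+ - p * 1#) (distanceBlock-diagonal p (part i)) ⟩
    p + - p * 1#                                  ≈⟨ +-congˡ (*-identityʳ (- p)) ⟩
    p - p                                         ≈⟨ -‿inverseʳ p ⟩
    0#                                            ∎)
    where
    p : Carrier
    p = q + 1#
  ... | no _ with part i xor part j
  ...   | true  = trans (qnum-1 q) (sym (x+y*0≈x 1# _))
  ...   | false = trans (qnum-2 q) (sym (x+y*0≈x (q + 1#) _))

module CompleteBipartiteMatrices {c ℓ} (F : Field c ℓ) (m n : ℕ) (q : Field.Carrier F) where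
  open Field F
  open FieldOps F
  open Blocks rawRing
  open BlockMatrices F (suc m) (suc n)
  open CompleteBipartite (q + 1#) (fromℕ m) (fromℕ n)
  open import Algebra.Properties.Ring ring using (-‿distribˡ-*)

  claimedInverse≈blockMatrix : claimedInverseK F (suc m) (suc n) q
    ≈ᴹ blockMatrix (scale (((q + 1#) * Δ) ⁻¹) inverseBlock) (- ((q + 1#) ⁻¹))
  claimedInverse≈blockMatrix i j = +-congˡ (-‿distribˡ-* _ _)

theorem3p5 : ∀ {c ℓ} (F : Field c ℓ) (s t : ℕ) → s ≥ 1 → t ≥ 1 → (q : Field.Carrier F) →
    ¬ (Field._≈_ F (Field._+_ F q (Field.1# F)) (Field.0# F)) →
    ¬ (Field._≈_ F
        (Field._*_ F (Field._*_ F (Field._*_ F (Field._+_ F q (Field.1# F)) (Field._+_ F q (Field.1# F)))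
           (FieldOps.fromℕ F (s ∸ 1))) (FieldOps.fromℕ F (t ∸ 1)))
        (Field._*_ F (FieldOps.fromℕ F s) (FieldOps.fromℕ F t))) →
    FieldOps.IsInverse F (FieldOps.qDistanceMatrix F q (distK s t)) (claimedInverseK F s t q)
theorem3p5 F (suc m) (suc n) (ℕ.s≤s ℕ.z≤n) (ℕ.s≤s ℕ.z≤n) q p≉0 p²ab≉st =
    (λ i j → trans (⊗-cong (qDistance≈blockMatrix q) claimedInverse≈blockMatrix i j)
                   (blockMatrix-inverse (distance⊛inverse≈0 p a b uΔ≈v) (-x*-x⁻¹≈1 p≉0) i j))
  , (λ i j → trans (⊗-cong claimedInverse≈blockMatrix (qDistance≈blockMatrix q) i j)
                   (blockMatrix-inverse (inverse⊛distance≈0 p a b uΔ≈v)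
                                        (trans (*-comm _ _) (-x*-x⁻¹≈1 p≉0)) i j))
  where
  open Field F
  open FieldOps F using (fromℕ)
  open FieldProperties F
  open Matrices F using (⊗-cong)
  open BlockMatrices F (suc m) (suc n)
  open CompleteBipartiteMatrices F m n q
  open CompleteBipartiteIdentities commutativeRing

  p a b : Carrier
  p = q + 1#
  a = fromℕ m
  b = fromℕ n

  open Blocks.CompleteBipartite rawRing p a b using (Δ)

  uΔ≈v : (p * Δ) ⁻¹ * Δ ≈ p ⁻¹
  uΔ≈v = [x*y]⁻¹*y≈x⁻¹ p≉0 (x≉y⇒x-y≉0 p²ab≉st)
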